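{- Let $n\ge1$. For every $J\subseteq\{1,\dots,n-1\}$, $$\varphi(X^0_J)=2^{1+\#J}\sum_{F\in\mathring{\mathcal F}_n,\ F\subseteq J\cup(J+1)}\mathring P_F\quad\text{and}\quad\varphi(Y^0_J)=\sum_{F\in\mathring{\mathcal F}_n,\ F\subseteq J\triangle(J+1)}2^{1+\#F}\mathring P_F.$$
   Context: Type B: $\mathcal B_n$ is the group of signed permutations (bijections $w$ of $\{\pm1,\dots,\pm n\}$ with $w(-i)=-w(i)$), written $w_1\cdots w_n$, negative entries $\bar k=-k$, ordered $\cdots<\bar2<\bar1<1<2<\cdots$; $\mathrm{Des}(w)=\{i\in\{0,\dots,n-1\}:w_i>w_{i+1}\}$ with $w_0=0$. For $J\subseteq\{0,\dots,n-1\}$, $Y_J=\sum_{\mathrm{Des}(w)=J}w$, $X_J=\sum_{I\subseteq J}Y_I$. For $J\subseteq\{1,\dots,n-1\}$ set $X^0_J=X_{\{0\}\cup J}$ and $Y^0_J=Y_{\{0\}\cup J}+Y_J$. $\varphi$ is the linear map $\mathbb Q\mathcal B_n\to\mathbb Q\mathcal S_n$ forgetting signs. $J+1=\{j+1:j\in J\}$, $\triangle$ is symmetric difference. Type A: for $u\in\mathcal S_n$, $\mathring{\mathrm{Peak}}(u)=\{i\in\{2,\dots,n-1\}:u_{i-1}<u_i>u_{i+1}\}$; $\mathring{\mathcal F}_n$ is the set of subsets of $\{2,\dots,n-1\}$ with no two consecutive integers; $\mathring P_F=\sum_{\mathring{\mathrm{Peak}}(u)=F}u$. -}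

module Defs where

open import Data.Bool using (Bool; true; false; _∧_; _∨_; not; _xor_; if_then_else_)
open import Data.Nat using (ℕ; zero; suc; _+_; _*_; _^_; _≤ᵇ_; _<ᵇ_; _<?_)
open import Data.Integer using (ℤ; +_; -_) renaming (_<?_ to _<ℤ?_)
open import Data.Fin using (Fin; toℕ; fromℕ<)
open import Data.Fin.Subset using (Subset; _∪_; ∣_∣)
open import Data.Fin.Permutation using (Permutation′; _⟨$⟩ʳ_)
open import Data.Vec using (Vec; []; _∷_; tabulate; lookup)
open import Data.Vec.Properties using (≡-dec)
open import Data.List using (List; []; _∷_; map; _++_)
open import Data.Bool.ListAction using (and)
open import Data.Nat.ListAction using (sum)
open import Data.Product using (_×_; _,_)
open import Relation.Nullary using (yes; no)
open import Relation.Nullary.Decidable using (isYes)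
import Data.Bool.Properties as BoolP
open import Data.Vec using (toList)

allBoolVecs : (n : ℕ) → List (Vec Bool n)
allBoolVecs zero = [] ∷ []
allBoolVecs (suc n) = map (true ∷_) (allBoolVecs n) ++ map (false ∷_) (allBoolVecs n)

-- A subset of {0,…,n-1} is a Subset n (position i : Fin n stands for the integer toℕ i).
allSubsets : (n : ℕ) → List (Subset n)
allSubsets = allBoolVecs

memℕ : {n : ℕ} → Subset n → ℕ → Bool
memℕ {n} S k with k <? n
... | yes p = lookup S (fromℕ< p)
... | no _ = false

_==ˢ_ : {n : ℕ} → Subset n → Subset n → Bool
S ==ˢ T = isYes (≡-dec BoolP._≟_ S T)

_⊆ᵇ_ : {n : ℕ} → Subset n → Subset n → Bool
S ⊆ᵇ T = and (toList (tabulate (λ i → not (lookup S i) ∨ lookup T i)))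

withZero : {n : ℕ} → Subset n → Subset n
withZero J = tabulate (λ i → isZero (toℕ i) ∨ lookup J i)
  where
  isZero : ℕ → Bool
  isZero zero = true
  isZero (suc _) = false

-- J + 1 = {j+1 : j ∈ J}, intersected with {0,…,n-1}
-- (the possible element n is dropped; it is irrelevant since it is only
--  ever compared with subsets of {2,…,n-1})
shift : {n : ℕ} → Subset n → Subset n
shift J = tabulate (λ i → pred? (toℕ i))
  where
  pred? : ℕ → Bool
  pred? zero = false
  pred? (suc k) = memℕ J k

_△_ : {n : ℕ} → Subset n → Subset n → Subset n
S △ T = tabulate (λ i → lookup S i xor lookup T i)

Perm : ℕ → Set
Perm n = Permutation′ n

-- u_k for 1 ≤ k ≤ n (one-line notation, values in {1,…,n}); 0 outside
entry : {n : ℕ} → Perm n → ℕ → ℕ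
entry u zero = 0
entry {n} u (suc k) with k <? n
... | yes p = suc (toℕ (u ⟨$⟩ʳ fromℕ< p))
... | no _ = 0

Peak : {n : ℕ} → Perm n → Subset n
Peak u = tabulate (λ i → (2 ≤ᵇ toℕ i) ∧ (entry u (pred (toℕ i)) <ᵇ entry u (toℕ i))
                                      ∧ (entry u (suc (toℕ i)) <ᵇ entry u (toℕ i)))
  where
  pred : ℕ → ℕ
  pred zero = zero
  pred (suc k) = k

isF : {n : ℕ} → Subset n → Bool
isF F = and (toList (tabulate (λ i →
          not (lookup F i) ∨ ((2 ≤ᵇ toℕ i) ∧ not (memℕ F (suc (toℕ i)))))))

-- Type B: signed permutations w = (u , s), w_k = u_k if s_k = false,
-- w_k = -u_k (i.e. \bar{u_k}) if s_k = true.  This is a bijection S_n × {±}^n ≅ B_n.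

Signs : ℕ → Set
Signs n = Vec Bool n

SPerm : ℕ → Set
SPerm n = Perm n × Signs n

-- w_k for 1 ≤ k ≤ n, and w_0 = 0
sentry : {n : ℕ} → SPerm n → ℕ → ℤ
sentry w zero = + 0
sentry {n} (u , s) (suc k) with k <? n
... | yes p = if lookup s (fromℕ< p) then - (+ entry u (suc k)) else + entry u (suc k)
... | no _ = + 0

Des : {n : ℕ} → SPerm n → Subset n
Des w = tabulate (λ i → isYes (sentry w (suc (toℕ i)) <ℤ? sentry w (toℕ i)))

-- Group algebras with (nonnegative integer) coefficients: an element is its
-- coefficient function.

QB : ℕ → Set
QB n = SPerm n → ℕ

QS : ℕ → Set
QS n = Perm n → ℕ

-- φ : forget signs; coefficient of u in φ(x) is the sum of coefficients of all
-- signed permutations whose underlying permutation is u.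
φ : {n : ℕ} → QB n → QS n
φ {n} x u = sum (map (λ s → x (u , s)) (allBoolVecs n))

Y : {n : ℕ} → Subset n → QB n
Y J w = if Des w ==ˢ J then 1 else 0

X : {n : ℕ} → Subset n → QB n
X {n} J w = sum (map (λ I → if I ⊆ᵇ J then Y I w else 0) (allSubsets n))

X⁰ : {n : ℕ} → Subset n → QB n
X⁰ J = X (withZero J)

Y⁰ : {n : ℕ} → Subset n → QB n
Y⁰ J w = Y (withZero J) w + Y J w

P : {n : ℕ} → Subset n → QS n
P F u = if Peak u ==ˢ F then 1 else 0

rhsX : {n : ℕ} → Subset n → QS n
rhsX {n} J u = 2 ^ (1 + ∣ J ∣) *
  sum (map (λ F → if isF F ∧ (F ⊆ᵇ (J ∪ shift J)) then P F u else 0) (allSubsets n))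

rhsY : {n : ℕ} → Subset n → QS n
rhsY {n} J u =
  sum (map (λ F → if isF F ∧ (F ⊆ᵇ (J △ shift J)) then 2 ^ (1 + ∣ F ∣) * P F u else 0) (allSubsets n))

{-# OPTIONS --safe #-}
-- Fix u ∈ S_n. As Peak(u) ∈ F̊_n, the right-hand sides have coefficient 2^{1+#J} [Peak(u) ⊆ J ∪ (J+1)]
-- resp. 2^{1+#Peak(u)} [Peak(u) ⊆ J △ (J+1)] at u. On the left, the coefficient counts the sign vectors s
-- for which the descents of w = (u , s) at positions 1, …, n-1 lie in J (resp. are exactly J).
-- Whether position i is a descent of w depends on a single sign: over an ascent u_i < u_{i+1} only on
-- the sign of w_{i+1}, over a descent only on the sign of w_i. So every position constrains exactly one
-- sign, and a sign is constrained twice exactly at an interior peak, where the two constraints are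
-- compatible iff the peak satisfies the condition above. The count is computed link by link by a
-- transfer recurrence that, after an ascent, looks one link further to see whether a peak follows.
module Submission where

open import Defs
open import Data.Nat using (ℕ; _≤_)
open import Data.Fin using (Fin; toℕ)
open import Data.Fin.Subset using (Subset; _∉_)
open import Data.Product using (_×_)
open import Relation.Binary.PropositionalEquality using (_≡_)

open import Data.Bool using (Bool; true; false; not; _∧_; _∨_; _xor_; if_then_else_)
open import Data.Bool.Properties using (∨-zeroʳ; ∧-zeroʳ; ∧-conicalʳ; if-eta; if-∧)
import Data.Bool.Properties as Bool
open import Data.Bool.ListAction using (and)
open import Data.Empty using (⊥-elim)
open import Data.Fin using (fromℕ<) renaming (zero to fzero; suc to fsuc)
open import Data.Fin.Properties using (toℕ-injective; fromℕ<-injective)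
open import Data.Fin.Subset using (_∪_; ∣_∣)
open import Data.Fin.Permutation using (_⟨$⟩ʳ_)
open import Data.Integer as ℤ using (ℤ; +<+; -<+; -<-) renaming (_<?_ to _<ℤ?_)
open import Data.List using (map; _++_)
open import Data.List.Properties using (map-++; map-cong; map-∘)
open import Data.Nat using (zero; suc; pred; _+_; _*_; _^_; _<_; _<ᵇ_; _≤ᵇ_; _<?_; s≤s; z<s; s<s)
open import Data.Nat.Properties
  using (+-identityʳ; +-comm; *-identityˡ; *-zeroʳ; *-assoc; *-distribˡ-+;
         <⇒≤; <-asym; <-cmp; m<n⇒m<1+n; 1+n≢n; suc-injective)
open import Data.Nat.ListAction using (sum)
open import Data.Nat.ListAction.Properties using (sum-++)
open import Data.Product using (_,_; proj₁)
open import Data.Vec using (Vec; []; _∷_; tabulate; lookup; toList; here)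
open import Data.Vec.Properties using (≡-dec; tabulate∘lookup; lookup∘tabulate; ∷-injectiveʳ)
open import Function using (_∘_)
open import Function.Bundles using (Injection)
open import Function.Properties.Inverse using (↔⇒↣)
open import Relation.Binary.Definitions using (tri<; tri≈; tri>)
open import Relation.Binary.PropositionalEquality using (_≢_; refl; sym; trans; cong; cong₂; module ≡-Reasoning)
open import Relation.Nullary using (¬_; yes; no; does)
open import Relation.Nullary.Decidable using (isYes; isYes≗does; dec-true; dec-false)

open ≡-Reasoning

ind : Bool → ℕ
ind b = if b then 1 else 0

sumBool : (Bool → ℕ) → ℕ
sumBool f = f true + f false

choices : (Bool → Bool) → ℕ
choices p = sumBool (ind ∘ p)

sumBool-cong : ∀ {f g : Bool → ℕ} → (∀ b → f b ≡ g b) → sumBool f ≡ sumBool g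
sumBool-cong f≗g = cong₂ _+_ (f≗g true) (f≗g false)

if-sum : ∀ a b x → (if a then x else 0) + (if b then x else 0) ≡ (ind a + ind b) * x
if-sum true  true  x = cong (x +_) (sym (+-identityʳ x))
if-sum true  false x = refl
if-sum false true  x = sym (+-identityʳ x)
if-sum false false x = refl

sumBool-if : ∀ (p : Bool → Bool) x → sumBool (λ b → if p b then x else 0) ≡ choices p * x
sumBool-if p = if-sum (p true) (p false)

x+x≡2*x : ∀ x → x + x ≡ 2 * x
x+x≡2*x x = cong (x +_) (sym (+-identityʳ x))

at : ∀ {n} → Vec Bool n → ℕ → Bool
at []      _       = false
at (b ∷ _) zero    = b
at (_ ∷ v) (suc k) = at v k

allBelow : ℕ → (ℕ → Bool) → Bool
allBelow zero    f = true
allBelow (suc m) f = f 0 ∧ allBelow m (f ∘ suc)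

countBelow : ℕ → (ℕ → Bool) → ℕ
countBelow zero    f = 0
countBelow (suc m) f = ind (f 0) + countBelow m (f ∘ suc)

allBelow-cong : ∀ m {f g : ℕ → Bool} → (∀ {k} → k < m → f k ≡ g k) → allBelow m f ≡ allBelow m g
allBelow-cong zero    f≗g = refl
allBelow-cong (suc m) f≗g = cong₂ _∧_ (f≗g z<s) (allBelow-cong m (f≗g ∘ s<s))

countBelow-cong : ∀ m {f g : ℕ → Bool} → (∀ {k} → k < m → f k ≡ g k) → countBelow m f ≡ countBelow m g
countBelow-cong zero    f≗g = refl
countBelow-cong (suc m) f≗g = cong₂ (λ b c → ind b + c) (f≗g z<s) (countBelow-cong m (f≗g ∘ s<s))

at-tabulate : ∀ {n} (g : ℕ → Bool) {k} → k < n → at (tabulate {n = n} (g ∘ toℕ)) k ≡ g k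
at-tabulate         g {zero}  z<s       = refl
at-tabulate {suc n} g {suc k} (s<s k<n) = at-tabulate {n} (g ∘ suc) k<n

at-tabulate-false : ∀ {n} (g : ℕ → Bool) {k} → g k ≡ false → at (tabulate {n = n} (g ∘ toℕ)) k ≡ false
at-tabulate-false {zero}  g         _  = refl
at-tabulate-false {suc n} g {zero}  gk = gk
at-tabulate-false {suc n} g {suc k} gk = at-tabulate-false {n} (g ∘ suc) gk

lookup-fromℕ< : ∀ {n} (v : Vec Bool n) {k} (k<n : k < n) → lookup v (fromℕ< k<n) ≡ at v k
lookup-fromℕ< (b ∷ v) {zero}  _         = refl
lookup-fromℕ< (b ∷ v) {suc k} (s<s k<n) = lookup-fromℕ< v k<n

at-≮ : ∀ {n} (v : Vec Bool n) {k} → ¬ k < n → at v k ≡ false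
at-≮ []      _   = refl
at-≮ (b ∷ v) {zero}  k≮n = ⊥-elim (k≮n z<s)
at-≮ (b ∷ v) {suc k} k≮n = at-≮ v (k≮n ∘ s<s)

memℕ-at : ∀ {n} (v : Vec Bool n) k → memℕ v k ≡ at v k
memℕ-at {n} v k with k <? n
... | yes k<n = lookup-fromℕ< v k<n
... | no  k≮n = sym (at-≮ v k≮n)

at-∪ : ∀ {n} (S T : Subset n) k → at (S ∪ T) k ≡ at S k ∨ at T k
at-∪ []      []      k       = refl
at-∪ (x ∷ S) (y ∷ T) zero    = refl
at-∪ (x ∷ S) (y ∷ T) (suc k) = at-∪ S T k

at-△ : ∀ {n} (S T : Subset n) k → at (S △ T) k ≡ at S k xor at T k
at-△ []      []      k       = refl
at-△ (x ∷ S) (y ∷ T) zero    = refl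
at-△ (x ∷ S) (y ∷ T) (suc k) = at-△ S T k

at-shift : ∀ {n} (J : Subset n) {k} → suc k < n → at (shift J) (suc k) ≡ at J k
at-shift {suc n} J {k} (s<s k<n) = trans (at-tabulate (memℕ J) k<n) (memℕ-at J k)

at-withZero : ∀ {n} b (J : Subset n) k → at (withZero (b ∷ J)) (suc k) ≡ at J k
at-withZero b J k = cong (λ v → at v k) (tabulate∘lookup J)

⊆ᵇ-allBelow : ∀ {n} (v w : Vec Bool n) → (v ⊆ᵇ w) ≡ allBelow n (λ k → not (at v k) ∨ at w k)
⊆ᵇ-allBelow []      []      = refl
⊆ᵇ-allBelow (x ∷ v) (y ∷ w) = cong ((not x ∨ y) ∧_) (⊆ᵇ-allBelow v w)

≟-does : ∀ x y → does (x Bool.≟ y) ≡ not (x xor y)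
≟-does true  true  = refl
≟-does true  false = refl
≟-does false true  = refl
≟-does false false = refl

==ˢ-allBelow : ∀ {n} (v w : Vec Bool n) → (v ==ˢ w) ≡ allBelow n (λ k → not (at v k xor at w k))
==ˢ-allBelow []      []      = refl
==ˢ-allBelow (x ∷ v) (y ∷ w) =
  trans (isYes≗does (≡-dec Bool._≟_ (x ∷ v) (y ∷ w)))
        (cong₂ _∧_ (≟-does x y) (trans (sym (isYes≗does (≡-dec Bool._≟_ v w))) (==ˢ-allBelow v w)))

==ˢ-refl : ∀ {n} (v : Vec Bool n) → (v ==ˢ v) ≡ true
==ˢ-refl v = trans (isYes≗does (≡-dec Bool._≟_ v v)) (dec-true (≡-dec Bool._≟_ v v) refl)

==ˢ-≢ : ∀ {n} {v w : Vec Bool n} → v ≢ w → (v ==ˢ w) ≡ false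
==ˢ-≢ {v = v} {w} v≢w = trans (isYes≗does (≡-dec Bool._≟_ v w)) (dec-false (≡-dec Bool._≟_ v w) v≢w)

∣∣-countBelow : ∀ {n} (v : Subset n) → ∣ v ∣ ≡ countBelow n (at v)
∣∣-countBelow []          = refl
∣∣-countBelow (true ∷ v)  = cong suc (∣∣-countBelow v)
∣∣-countBelow (false ∷ v) = ∣∣-countBelow v

and-tabulate-true : ∀ {n} (f : Fin n → Bool) → (∀ i → f i ≡ true) → and (toList (tabulate f)) ≡ true
and-tabulate-true {zero}  f _  = refl
and-tabulate-true {suc n} f ≡true = cong₂ _∧_ (≡true fzero) (and-tabulate-true (f ∘ fsuc) (≡true ∘ fsuc))

sumAll : ∀ n → (Vec Bool n → ℕ) → ℕ
sumAll n f = sum (map f (allBoolVecs n))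

sumAll-suc : ∀ {n} (f : Vec Bool (suc n) → ℕ) →
             sumAll (suc n) f ≡ sumAll n (f ∘ (true ∷_)) + sumAll n (f ∘ (false ∷_))
sumAll-suc {n} f = begin
  sum (map f (map (true ∷_) vs ++ map (false ∷_) vs))
    ≡⟨ cong sum (map-++ f (map (true ∷_) vs) (map (false ∷_) vs)) ⟩
  sum (map f (map (true ∷_) vs) ++ map f (map (false ∷_) vs))
    ≡⟨ sum-++ (map f (map (true ∷_) vs)) (map f (map (false ∷_) vs)) ⟩
  sum (map f (map (true ∷_) vs)) + sum (map f (map (false ∷_) vs))
    ≡⟨ cong₂ _+_ (cong sum (map-∘ vs)) (cong sum (map-∘ vs)) ⟨
  sumAll n (f ∘ (true ∷_)) + sumAll n (f ∘ (false ∷_))           ∎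
  where vs = allBoolVecs n

sumAll-cong : ∀ {n} {f g : Vec Bool n → ℕ} → (∀ v → f v ≡ g v) → sumAll n f ≡ sumAll n g
sumAll-cong {n} f≗g = cong sum (map-cong f≗g (allBoolVecs n))

sumAll-zero : ∀ {n} {f : Vec Bool n → ℕ} → (∀ v → f v ≡ 0) → sumAll n f ≡ 0
sumAll-zero {zero}  f≡0 = cong (_+ 0) (f≡0 [])
sumAll-zero {suc n} {f} f≡0 =
  trans (sumAll-suc f) (cong₂ _+_ (sumAll-zero {f = f ∘ (true ∷_)} (f≡0 ∘ (true ∷_)))
                                  (sumAll-zero {f = f ∘ (false ∷_)} (f≡0 ∘ (false ∷_))))

sumAll-single : ∀ {n} (d : Vec Bool n) {f : Vec Bool n → ℕ} → (∀ v → v ≢ d → f v ≡ 0) → sumAll n f ≡ f d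
sumAll-single []          f≡0 = +-identityʳ _
sumAll-single (true ∷ d)  {f} f≡0 = trans (sumAll-suc f) (trans
  (cong₂ _+_ (sumAll-single d (λ v v≢d → f≡0 _ (v≢d ∘ ∷-injectiveʳ)))
             (sumAll-zero {f = f ∘ (false ∷_)} (λ v → f≡0 _ λ ())))
  (+-identityʳ _))
sumAll-single (false ∷ d) {f} f≡0 = trans (sumAll-suc f)
  (cong₂ _+_ (sumAll-zero {f = f ∘ (true ∷_)} (λ v → f≡0 _ λ ()))
             (sumAll-single d (λ v v≢d → f≡0 _ (v≢d ∘ ∷-injectiveʳ))))

sumAll-==ˢ : ∀ {n} (d : Vec Bool n) (g : Vec Bool n → Bool → ℕ) → (∀ v → g v false ≡ 0) →
             sumAll n (λ v → g v (d ==ˢ v)) ≡ g d true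
sumAll-==ˢ d g g≡0 =
  trans (sumAll-single d (λ v v≢d → trans (cong (g v) (==ˢ-≢ (v≢d ∘ sym))) (g≡0 v))) (cong (g d) (==ˢ-refl d))

sumAll-ind-∧ : ∀ {n} b (f : Vec Bool n → Bool) →
               sumAll n (λ v → ind (b ∧ f v)) ≡ (if b then sumAll n (ind ∘ f) else 0)
sumAll-ind-∧ true  f = refl
sumAll-ind-∧ {n} false f = sumAll-zero {n} (λ _ → refl)

signed : ℕ → Bool → ℤ
signed a σ = if σ then ℤ.- (ℤ.+ a) else ℤ.+ a

descentᵇ : ℕ → Bool → ℕ → Bool → Bool
descentᵇ a σa b σb = isYes (signed b σb <ℤ? signed a σa)

descentᵇ-true : ∀ a σa b σb → signed b σb ℤ.< signed a σa → descentᵇ a σa b σb ≡ true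
descentᵇ-true a σa b σb lt = trans (isYes≗does b<a?) (dec-true b<a? lt)
  where b<a? = signed b σb <ℤ? signed a σa

descentᵇ-false : ∀ a σa b σb → ¬ signed b σb ℤ.< signed a σa → descentᵇ a σa b σb ≡ false
descentᵇ-false a σa b σb ≮ = trans (isYes≗does b<a?) (dec-false b<a? ≮)
  where b<a? = signed b σb <ℤ? signed a σa

descentᵇ-asc : ∀ {a b} σa σb → a < b → descentᵇ a σa b σb ≡ σb
descentᵇ-asc {a}     {suc b} false false a<b =
  descentᵇ-false a false (suc b) false λ { (+<+ b<a) → <-asym a<b b<a }
descentᵇ-asc {a}     {suc b} false true  _   = descentᵇ-true a false (suc b) true -<+
descentᵇ-asc {zero}  {suc b} true  false _   = descentᵇ-false zero true (suc b) false λ { (+<+ ()) }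
descentᵇ-asc {suc a} {suc b} true  false _   = descentᵇ-false (suc a) true (suc b) false λ ()
descentᵇ-asc {zero}  {suc b} true  true  _   = descentᵇ-true zero true (suc b) true -<+
descentᵇ-asc {suc a} {suc b} true  true  (s<s a<b) = descentᵇ-true (suc a) true (suc b) true (-<- a<b)

descentᵇ-desc : ∀ {a b} σa σb → b < a → descentᵇ a σa b σb ≡ not σa
descentᵇ-desc {suc a} {b}     false false b<a = descentᵇ-true (suc a) false b false (+<+ b<a)
descentᵇ-desc {suc a} {zero}  false true  _   = descentᵇ-true (suc a) false zero true (+<+ z<s)
descentᵇ-desc {suc a} {suc b} false true  _   = descentᵇ-true (suc a) false (suc b) true -<+
descentᵇ-desc {suc a} {b}     true  false _   = descentᵇ-false (suc a) true b false λ ()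
descentᵇ-desc {suc a} {zero}  true  true  _   = descentᵇ-false (suc a) true zero true λ ()
descentᵇ-desc {suc a} {suc b} true  true  (s<s b<a) =
  descentᵇ-false (suc a) true (suc b) true λ { (-<- a<b) → <-asym a<b b<a }

-- Counting sign vectors along a chain of links

AdjacentDistinct : (ℕ → ℕ) → ℕ → Set
AdjacentDistinct e m = ∀ {k} → k < m → e k ≢ e (suc k)

-- e k and σ k are the absolute value and the sign of w_{k+1}. Link k joins entries k and k+1, i.e. it is
-- position k+1 of Des(w), and carries the label j k (whether k+1 ∈ J). The rule c j d says whether the
-- descent bit d is allowed on a link labelled j.
module Chain (c : Bool → Bool → Bool) where

  admissible : (ℕ → ℕ) → (ℕ → Bool) → ℕ → (ℕ → Bool) → Bool
  admissible e j m σ = allBelow m (λ k → c (j k) (descentᵇ (e k) (σ k) (e (suc k)) (σ (suc k))))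

  extensions : (ℕ → ℕ) → (ℕ → Bool) → ℕ → Bool → ℕ
  extensions e j zero    σ₀ = 1
  extensions e j (suc m) σ₀ = sumBool λ σ₁ →
    if c (j 0) (descentᵇ (e 0) σ₀ (e 1) σ₁) then extensions (e ∘ suc) (j ∘ suc) m σ₁ else 0

  total : (ℕ → ℕ) → (ℕ → Bool) → ℕ → ℕ
  total e j m = sumBool (extensions e j m)

  sumAll-extensions : ∀ m e j σ₀ →
                      sumAll m (λ s → ind (admissible e j m (at (σ₀ ∷ s)))) ≡ extensions e j m σ₀
  sumAll-extensions zero    e j σ₀ = refl
  sumAll-extensions (suc m) e j σ₀ =
    trans (sumAll-suc {m} (λ s → ind (admissible e j (suc m) (at (σ₀ ∷ s)))))
          (cong₂ _+_ (first-link true) (first-link false))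
    where
    first-link : ∀ σ₁ →
      sumAll m (λ s → ind (c (j 0) (descentᵇ (e 0) σ₀ (e 1) σ₁) ∧ admissible (e ∘ suc) (j ∘ suc) m (at (σ₁ ∷ s))))
      ≡ (if c (j 0) (descentᵇ (e 0) σ₀ (e 1) σ₁) then extensions (e ∘ suc) (j ∘ suc) m σ₁ else 0)
    first-link σ₁ = trans
      (sumAll-ind-∧ {m} _ (λ s → admissible (e ∘ suc) (j ∘ suc) m (at (σ₁ ∷ s))))
      (cong (λ x → if c (j 0) (descentᵇ (e 0) σ₀ (e 1) σ₁) then x else 0)
            (sumAll-extensions m (e ∘ suc) (j ∘ suc) σ₁))

  φ≡total : ∀ {m e j} (x : QB (suc m)) u → (∀ s → x (u , s) ≡ ind (admissible e j m (at s))) →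
            φ x u ≡ total e j m
  φ≡total {m} {e} {j} x u coeff = trans (sumAll-cong {suc m} coeff) (trans
    (sumAll-suc {m} (λ s → ind (admissible e j m (at s))))
    (cong₂ _+_ (sumAll-extensions m e j true) (sumAll-extensions m e j false)))

  ascentExtensions : (ℕ → ℕ) → (ℕ → Bool) → ℕ → ℕ
  ascentExtensions e j m = sumBool λ σ₁ → if c (j 0) σ₁ then extensions (e ∘ suc) (j ∘ suc) m σ₁ else 0

  extensions-asc : ∀ e j m σ₀ → e 0 < e 1 → extensions e j (suc m) σ₀ ≡ ascentExtensions e j m
  extensions-asc e j m σ₀ e₀<e₁ = sumBool-cong λ σ₁ →
    cong (λ d → if c (j 0) d then extensions (e ∘ suc) (j ∘ suc) m σ₁ else 0) (descentᵇ-asc σ₀ σ₁ e₀<e₁)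

  extensions-desc : ∀ e j m σ₀ → e 1 < e 0 →
                    extensions e j (suc m) σ₀ ≡ (if c (j 0) (not σ₀) then total (e ∘ suc) (j ∘ suc) m else 0)
  extensions-desc e j m σ₀ e₁<e₀ = trans
    (sumBool-cong λ σ₁ →
       cong (λ d → if c (j 0) d then extensions (e ∘ suc) (j ∘ suc) m σ₁ else 0) (descentᵇ-desc σ₀ σ₁ e₁<e₀))
    (if-sumBool (c (j 0) (not σ₀)))
    where
    if-sumBool : ∀ b → sumBool (λ σ₁ → if b then extensions (e ∘ suc) (j ∘ suc) m σ₁ else 0)
                       ≡ (if b then total (e ∘ suc) (j ∘ suc) m else 0)
    if-sumBool true  = refl
    if-sumBool false = refl

  total-asc : ∀ e j m → e 0 < e 1 → total e j (suc m) ≡ ascentExtensions e j m + ascentExtensions e j m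
  total-asc e j m e₀<e₁ = cong₂ _+_ (extensions-asc e j m true e₀<e₁) (extensions-asc e j m false e₀<e₁)

  record TransferRecurrence (τ : (ℕ → ℕ) → (ℕ → Bool) → ℕ → ℕ) : Set where
    field
      τ-zero     : ∀ e j → τ e j 0 ≡ 2
      τ-desc     : ∀ e j m → e 1 < e 0 →
                   τ e j (suc m) ≡ choices (c (j 0) ∘ not) * τ (e ∘ suc) (j ∘ suc) m
      τ-asc-last : ∀ e j → e 0 < e 1 → τ e j 1 ≡ 2 * choices (c (j 0))
      τ-asc      : ∀ e j m → e 0 < e 1 → e 1 < e 2 →
                   τ e j (2 + m) ≡ choices (c (j 0)) * τ (e ∘ suc) (j ∘ suc) (suc m)
      τ-peak     : ∀ e j m → e 0 < e 1 → e 2 < e 1 →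
                   τ e j (2 + m) ≡ 2 * (choices (λ σ → c (j 0) σ ∧ c (j 1) (not σ))
                                        * τ (e ∘ suc ∘ suc) (j ∘ suc ∘ suc) m)

  module _ {τ} (rec : TransferRecurrence τ) where
    open TransferRecurrence rec

    desc-step : ∀ e j m → e 1 < e 0 → total (e ∘ suc) (j ∘ suc) m ≡ τ (e ∘ suc) (j ∘ suc) m →
                total e j (suc m) ≡ τ e j (suc m)
    desc-step e j m e₁<e₀ ih = begin
      total e j (suc m)
        ≡⟨ cong₂ _+_ (extensions-desc e j m true e₁<e₀) (extensions-desc e j m false e₁<e₀) ⟩
      (if c (j 0) false then total′ else 0) + (if c (j 0) true then total′ else 0)
        ≡⟨ if-sum (c (j 0) false) (c (j 0) true) total′ ⟩
      choices (c (j 0) ∘ not) * total′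
        ≡⟨ cong (choices (c (j 0) ∘ not) *_) ih ⟩
      choices (c (j 0) ∘ not) * τ (e ∘ suc) (j ∘ suc) m
        ≡⟨ τ-desc e j m e₁<e₀ ⟨
      τ e j (suc m) ∎
      where total′ = total (e ∘ suc) (j ∘ suc) m

    asc-last-step : ∀ e j → e 0 < e 1 → total e j 1 ≡ τ e j 1
    asc-last-step e j e₀<e₁ =
      trans (total-asc e j 0 e₀<e₁) (trans (x+x≡2*x (ascentExtensions e j 0)) (sym (τ-asc-last e j e₀<e₁)))

    asc-step : ∀ e j m → e 0 < e 1 → e 1 < e 2 →
               total (e ∘ suc) (j ∘ suc) (suc m) ≡ τ (e ∘ suc) (j ∘ suc) (suc m) →
               total e j (2 + m) ≡ τ e j (2 + m)
    asc-step e j m e₀<e₁ e₁<e₂ ih = begin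
      total e j (2 + m)
        ≡⟨ total-asc e j (suc m) e₀<e₁ ⟩
      ascentExtensions e j (suc m) + ascentExtensions e j (suc m)
        ≡⟨ cong₂ _+_ factor factor ⟩
      choices (c (j 0)) * a′ + choices (c (j 0)) * a′
        ≡⟨ *-distribˡ-+ (choices (c (j 0))) a′ a′ ⟨
      choices (c (j 0)) * (a′ + a′)
        ≡⟨ cong (choices (c (j 0)) *_) (trans (sym (total-asc (e ∘ suc) (j ∘ suc) m e₁<e₂)) ih) ⟩
      choices (c (j 0)) * τ (e ∘ suc) (j ∘ suc) (suc m)
        ≡⟨ τ-asc e j m e₀<e₁ e₁<e₂ ⟨
      τ e j (2 + m) ∎
      where
      a′ = ascentExtensions (e ∘ suc) (j ∘ suc) m
      factor : ascentExtensions e j (suc m) ≡ choices (c (j 0)) * a′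
      factor = trans
        (sumBool-cong λ σ₁ →
           cong (λ x → if c (j 0) σ₁ then x else 0) (extensions-asc (e ∘ suc) (j ∘ suc) m σ₁ e₁<e₂))
        (sumBool-if (c (j 0)) a′)

    peak-step : ∀ e j m → e 0 < e 1 → e 2 < e 1 →
                total (e ∘ suc ∘ suc) (j ∘ suc ∘ suc) m ≡ τ (e ∘ suc ∘ suc) (j ∘ suc ∘ suc) m →
                total e j (2 + m) ≡ τ e j (2 + m)
    peak-step e j m e₀<e₁ e₂<e₁ ih = begin
      total e j (2 + m)
        ≡⟨ total-asc e j (suc m) e₀<e₁ ⟩
      ascentExtensions e j (suc m) + ascentExtensions e j (suc m)
        ≡⟨ cong₂ _+_ factor factor ⟩
      peakChoices * total″ + peakChoices * total″
        ≡⟨ x+x≡2*x (peakChoices * total″) ⟩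
      2 * (peakChoices * total″)
        ≡⟨ cong (λ t → 2 * (peakChoices * t)) ih ⟩
      2 * (peakChoices * τ (e ∘ suc ∘ suc) (j ∘ suc ∘ suc) m)
        ≡⟨ τ-peak e j m e₀<e₁ e₂<e₁ ⟨
      τ e j (2 + m) ∎
      where
      total″ = total (e ∘ suc ∘ suc) (j ∘ suc ∘ suc) m
      peakChoices = choices (λ σ → c (j 0) σ ∧ c (j 1) (not σ))
      factor : ascentExtensions e j (suc m) ≡ peakChoices * total″
      factor = trans
        (sumBool-cong λ σ₁ → trans
           (cong (λ x → if c (j 0) σ₁ then x else 0) (extensions-desc (e ∘ suc) (j ∘ suc) m σ₁ e₂<e₁))
           (sym (if-∧ (c (j 0) σ₁) {c (j 1) (not σ₁)} {total″} {0})))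
        (sumBool-if (λ σ → c (j 0) σ ∧ c (j 1) (not σ)) total″)

    TotalIsτ : ℕ → Set
    TotalIsτ m = ∀ e j → AdjacentDistinct e m → total e j m ≡ τ e j m

    total≡τ-1 : TotalIsτ 1
    total≡τ-1 e j distinct with <-cmp (e 0) (e 1)
    ... | tri≈ _ e₀≡e₁ _ = ⊥-elim (distinct z<s e₀≡e₁)
    ... | tri< e₀<e₁ _ _ = asc-last-step e j e₀<e₁
    ... | tri> _ _ e₁<e₀ = desc-step e j 0 e₁<e₀ (sym (τ-zero (e ∘ suc) (j ∘ suc)))

    total≡τ-2+ : ∀ m → TotalIsτ m → TotalIsτ (suc m) → TotalIsτ (2 + m)
    total≡τ-2+ m ih₀ ih₁ e j distinct with <-cmp (e 0) (e 1) | <-cmp (e 1) (e 2)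
    ... | tri≈ _ e₀≡e₁ _ | _              = ⊥-elim (distinct z<s e₀≡e₁)
    ... | tri> _ _ e₁<e₀ | _              = desc-step e j (suc m) e₁<e₀ (ih₁ _ _ (distinct ∘ s<s))
    ... | tri< _ _ _     | tri≈ _ e₁≡e₂ _ = ⊥-elim (distinct (s<s z<s) e₁≡e₂)
    ... | tri< e₀<e₁ _ _ | tri< e₁<e₂ _ _ = asc-step e j m e₀<e₁ e₁<e₂ (ih₁ _ _ (distinct ∘ s<s))
    ... | tri< e₀<e₁ _ _ | tri> _ _ e₂<e₁ = peak-step e j m e₀<e₁ e₂<e₁ (ih₀ _ _ (distinct ∘ s<s ∘ s<s))

    total≡τ-pair : ∀ m → TotalIsτ m × TotalIsτ (suc m)
    total≡τ-pair zero    = (λ e j _ → sym (τ-zero e j)) , total≡τ-1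
    total≡τ-pair (suc m) = let ih₀ , ih₁ = total≡τ-pair m in ih₁ , total≡τ-2+ m ih₀ ih₁

    total≡τ : ∀ m → TotalIsτ m
    total≡τ m = proj₁ (total≡τ-pair m)

<ᵇ-true : ∀ {a b} → a < b → (a <ᵇ b) ≡ true
<ᵇ-true {zero}  {suc b} _         = refl
<ᵇ-true {suc a} {suc b} (s≤s a<b) = <ᵇ-true a<b

<ᵇ-false : ∀ {a b} → b ≤ a → (a <ᵇ b) ≡ false
<ᵇ-false {a}     {zero}  _         = refl
<ᵇ-false {suc a} {suc b} (s≤s b≤a) = <ᵇ-false b≤a

<ᵇ-asym : ∀ a b → (a <ᵇ b) ≡ true → (b <ᵇ a) ≡ false
<ᵇ-asym zero    (suc b) _   = refl
<ᵇ-asym (suc a) (suc b) a<b = <ᵇ-asym a b a<b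

-- peakᵇ e r: a peak of e at index r+1, i.e. at position r+2 of u when e k = u_{k+1}.
peakᵇ : (ℕ → ℕ) → ℕ → Bool
peakᵇ e r = (e r <ᵇ e (suc r)) ∧ (e (suc (suc r)) <ᵇ e (suc r))

peaksSatisfy : (Bool → Bool → Bool) → (ℕ → ℕ) → (ℕ → Bool) → ℕ → Bool
peaksSatisfy _⊙_ e j m = allBelow (pred m) (λ r → not (peakᵇ e r) ∨ (j (suc r) ⊙ j r))

peakCount : (ℕ → ℕ) → ℕ → ℕ
peakCount e m = countBelow (pred m) (peakᵇ e)

peakᵇ-desc : ∀ e → e 1 < e 0 → peakᵇ e 0 ≡ false
peakᵇ-desc e e₁<e₀ = cong (_∧ (e 2 <ᵇ e 1)) (<ᵇ-false (<⇒≤ e₁<e₀))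

peakᵇ-asc : ∀ e → e 1 < e 2 → peakᵇ e 0 ≡ false
peakᵇ-asc e e₁<e₂ = trans (cong ((e 0 <ᵇ e 1) ∧_) (<ᵇ-false (<⇒≤ e₁<e₂))) (∧-zeroʳ (e 0 <ᵇ e 1))

peakᵇ-peak : ∀ e → e 0 < e 1 → e 2 < e 1 → peakᵇ e 0 ≡ true
peakᵇ-peak e e₀<e₁ e₂<e₁ = cong₂ _∧_ (<ᵇ-true e₀<e₁) (<ᵇ-true e₂<e₁)

peakᵇ-isolated : ∀ e r → peakᵇ e r ≡ true → peakᵇ e (suc r) ≡ false
peakᵇ-isolated e r peak =
  cong (_∧ (e (3 + r) <ᵇ e (2 + r))) (<ᵇ-asym (e (2 + r)) (e (suc r)) (∧-conicalʳ (e r <ᵇ e (suc r)) _ peak))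

module _ (_⊙_ : Bool → Bool → Bool) where

  peaksSatisfy-shift : ∀ e j m → peakᵇ e 0 ≡ false →
                       peaksSatisfy _⊙_ e j (2 + m) ≡ peaksSatisfy _⊙_ (e ∘ suc) (j ∘ suc) (suc m)
  peaksSatisfy-shift e j m no-peak =
    cong (λ p → (not p ∨ (j 1 ⊙ j 0)) ∧ peaksSatisfy _⊙_ (e ∘ suc) (j ∘ suc) (suc m)) no-peak

  peaksSatisfy-desc : ∀ e j m → e 1 < e 0 →
                      peaksSatisfy _⊙_ e j (suc m) ≡ peaksSatisfy _⊙_ (e ∘ suc) (j ∘ suc) m
  peaksSatisfy-desc e j zero    _     = refl
  peaksSatisfy-desc e j (suc m) e₁<e₀ = peaksSatisfy-shift e j m (peakᵇ-desc e e₁<e₀)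

  peaksSatisfy-peak : ∀ e j m → e 0 < e 1 → e 2 < e 1 →
                      peaksSatisfy _⊙_ e j (2 + m)
                      ≡ (j 1 ⊙ j 0) ∧ peaksSatisfy _⊙_ (e ∘ suc ∘ suc) (j ∘ suc ∘ suc) m
  peaksSatisfy-peak e j m e₀<e₁ e₂<e₁ =
    cong₂ (λ p x → (not p ∨ (j 1 ⊙ j 0)) ∧ x) (peakᵇ-peak e e₀<e₁ e₂<e₁)
          (peaksSatisfy-desc (e ∘ suc) (j ∘ suc) m e₂<e₁)

peakCount-shift : ∀ e m → peakᵇ e 0 ≡ false → peakCount e (2 + m) ≡ peakCount (e ∘ suc) (suc m)
peakCount-shift e m no-peak = cong (λ p → ind p + peakCount (e ∘ suc) (suc m)) no-peak

peakCount-desc : ∀ e m → e 1 < e 0 → peakCount e (suc m) ≡ peakCount (e ∘ suc) m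
peakCount-desc e zero    _     = refl
peakCount-desc e (suc m) e₁<e₀ = peakCount-shift e m (peakᵇ-desc e e₁<e₀)

peakCount-peak : ∀ e m → e 0 < e 1 → e 2 < e 1 → peakCount e (2 + m) ≡ 1 + peakCount (e ∘ suc ∘ suc) m
peakCount-peak e m e₀<e₁ e₂<e₁ =
  cong₂ (λ p k → ind p + k) (peakᵇ-peak e e₀<e₁ e₂<e₁) (peakCount-desc (e ∘ suc) m e₂<e₁)

-- X⁰_J admits a descent at a position i ≥ 1 only if i ∈ J; Y⁰_J requires the descents there to be J.
cX : Bool → Bool → Bool
cX j d = not d ∨ j

cY : Bool → Bool → Bool
cY j d = not (d xor j)

τX : (ℕ → ℕ) → (ℕ → Bool) → ℕ → ℕ
τX e j m = 2 ^ (1 + countBelow m j) * ind (peaksSatisfy _∨_ e j m)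

τY : (ℕ → ℕ) → (ℕ → Bool) → ℕ → ℕ
τY e j m = 2 ^ (1 + peakCount e m) * ind (peaksSatisfy _xor_ e j m)

2^-ind : ∀ b k x → 2 ^ (1 + (ind b + k)) * x ≡ (1 + ind b) * (2 ^ (1 + k) * x)
2^-ind false k x = sym (*-identityˡ _)
2^-ind true  k x = *-assoc 2 (2 ^ (1 + k)) x

2*-twice : ∀ p x → (2 * p) * x ≡ 2 * (1 * (p * x))
2*-twice p x = trans (*-assoc 2 p x) (cong (2 *_) (sym (*-identityˡ (p * x))))

open Chain.TransferRecurrence

X-recurrence : Chain.TransferRecurrence cX τX
X-recurrence .τ-zero e j = refl
X-recurrence .τ-desc e j m e₁<e₀ = trans
  (cong (λ b → 2 ^ (1 + countBelow (suc m) j) * ind b) (peaksSatisfy-desc _∨_ e j m e₁<e₀))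
  (2^-ind (j 0) (countBelow m (j ∘ suc)) (ind (peaksSatisfy _∨_ (e ∘ suc) (j ∘ suc) m)))
X-recurrence .τ-asc-last e j _ = asc-last (j 0)
  where
  asc-last : ∀ b → 2 ^ (1 + (ind b + 0)) * 1 ≡ 2 * (ind b + 1)
  asc-last true  = refl
  asc-last false = refl
X-recurrence .τ-asc e j m _ e₁<e₂ = trans
  (cong (λ b → 2 ^ (1 + countBelow (2 + m) j) * ind b) (peaksSatisfy-shift _∨_ e j m (peakᵇ-asc e e₁<e₂)))
  (trans (2^-ind (j 0) (countBelow (suc m) (j ∘ suc)) (ind (peaksSatisfy _∨_ (e ∘ suc) (j ∘ suc) (suc m))))
         (cong (_* τX (e ∘ suc) (j ∘ suc) (suc m)) (+-comm 1 (ind (j 0)))))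
X-recurrence .τ-peak e j m e₀<e₁ e₂<e₁ = trans
  (cong (λ b → 2 ^ (1 + countBelow (2 + m) j) * ind b) (peaksSatisfy-peak _∨_ e j m e₀<e₁ e₂<e₁))
  (peak (j 0) (j 1) (countBelow m (j ∘ suc ∘ suc)) (peaksSatisfy _∨_ (e ∘ suc ∘ suc) (j ∘ suc ∘ suc) m))
  where
  peak : ∀ a b k x → 2 ^ (1 + (ind a + (ind b + k))) * ind ((b ∨ a) ∧ x)
                   ≡ 2 * ((ind (a ∧ true) + ind b) * (2 ^ (1 + k) * ind x))
  peak true  true  k x =
    trans (*-assoc 2 (2 * 2 ^ (1 + k)) (ind x)) (cong (2 *_) (*-assoc 2 (2 ^ (1 + k)) (ind x)))
  peak true  false k x = 2*-twice (2 ^ (1 + k)) (ind x)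
  peak false true  k x = 2*-twice (2 ^ (1 + k)) (ind x)
  peak false false k x = *-zeroʳ (2 ^ (1 + k))

choices-cY : ∀ b → choices (cY b) ≡ 1
choices-cY true  = refl
choices-cY false = refl

choices-cY∘not : ∀ b → choices (cY b ∘ not) ≡ 1
choices-cY∘not true  = refl
choices-cY∘not false = refl

Y-recurrence : Chain.TransferRecurrence cY τY
Y-recurrence .τ-zero e j = refl
Y-recurrence .τ-desc e j m e₁<e₀ = trans
  (cong₂ (λ k b → 2 ^ (1 + k) * ind b) (peakCount-desc e m e₁<e₀) (peaksSatisfy-desc _xor_ e j m e₁<e₀))
  (sym (trans (cong (_* τY (e ∘ suc) (j ∘ suc) m) (choices-cY∘not (j 0))) (*-identityˡ _)))
Y-recurrence .τ-asc-last e j _ = sym (cong (2 *_) (choices-cY (j 0)))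
Y-recurrence .τ-asc e j m _ e₁<e₂ = trans
  (cong₂ (λ k b → 2 ^ (1 + k) * ind b) (peakCount-shift e m (peakᵇ-asc e e₁<e₂))
                                       (peaksSatisfy-shift _xor_ e j m (peakᵇ-asc e e₁<e₂)))
  (sym (trans (cong (_* τY (e ∘ suc) (j ∘ suc) (suc m)) (choices-cY (j 0))) (*-identityˡ _)))
Y-recurrence .τ-peak e j m e₀<e₁ e₂<e₁ = trans
  (cong₂ (λ k b → 2 ^ (1 + k) * ind b) (peakCount-peak e m e₀<e₁ e₂<e₁)
                                       (peaksSatisfy-peak _xor_ e j m e₀<e₁ e₂<e₁))
  (peak (j 0) (j 1) (2 ^ (1 + peakCount (e ∘ suc ∘ suc) m))
                    (peaksSatisfy _xor_ (e ∘ suc ∘ suc) (j ∘ suc ∘ suc) m))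
  where
  peak : ∀ a b p x → (2 * p) * ind ((b xor a) ∧ x)
                   ≡ 2 * ((ind (not (not a) ∧ not b) + ind (not a ∧ not (not b))) * (p * ind x))
  peak true  true  p x = *-zeroʳ (2 * p)
  peak true  false p x = 2*-twice p (ind x)
  peak false true  p x = 2*-twice p (ind x)
  peak false false p x = *-zeroʳ (2 * p)

entries : ∀ {n} → Perm n → ℕ → ℕ
entries u k = entry u (suc k)

entry-suc : ∀ {n} (u : Perm n) {k} (k<n : k < n) → entry u (suc k) ≡ suc (toℕ (u ⟨$⟩ʳ fromℕ< k<n))
entry-suc {n} u {k} k<n with k <? n
... | yes _   = refl
... | no  k≮n = ⊥-elim (k≮n k<n)

entries-distinct : ∀ {m} (u : Perm (suc m)) → AdjacentDistinct (entries u) m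
entries-distinct {m} u {k} k<m u₍k₊₁₎≡u₍k₊₂₎ =
  1+n≢n (sym (fromℕ<-injective k (suc k) k<1+m 1+k<1+m
  (Injection.injective (↔⇒↣ u) (toℕ-injective (suc-injective
    (trans (sym (entry-suc u k<1+m)) (trans u₍k₊₁₎≡u₍k₊₂₎ (entry-suc u 1+k<1+m))))))))
  where
  k<1+m   = m<n⇒m<1+n k<m
  1+k<1+m = s<s k<m

sentry-suc : ∀ {n} (u : Perm n) (s : Signs n) {k} → k < n →
             sentry (u , s) (suc k) ≡ signed (entry u (suc k)) (at s k)
sentry-suc {n} u s {k} k<n with k <? n
... | yes k<n′ = cong₂ signed (entry-suc u k<n′) (lookup-fromℕ< s k<n′)
... | no  k≮n  = ⊥-elim (k≮n k<n)

at-Des : ∀ {m} (u : Perm (suc m)) (s : Signs (suc m)) {k} → k < m →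
         at (Des (u , s)) (suc k) ≡ descentᵇ (entries u k) (at s k) (entries u (suc k)) (at s (suc k))
at-Des u s {k} k<m = trans
  (at-tabulate (λ p → isYes (sentry (u , s) (suc p) <ℤ? sentry (u , s) p)) (s<s k<m))
  (cong₂ (λ x y → isYes (x <ℤ? y)) (sentry-suc u s (s<s k<m)) (sentry-suc u s (m<n⇒m<1+n k<m)))

X-coefficient : ∀ {n} (K : Subset n) (w : SPerm n) → X K w ≡ ind (Des w ⊆ᵇ K)
X-coefficient K w = sumAll-==ˢ (Des w) (λ I b → if I ⊆ᵇ K then ind b else 0) (λ I → if-eta (I ⊆ᵇ K))

X⁰-coefficient : ∀ {m} (J : Subset m) (u : Perm (suc m)) (s : Signs (suc m)) →
                 X⁰ (false ∷ J) (u , s) ≡ ind (Chain.admissible cX (entries u) (at J) m (at s))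
X⁰-coefficient {m} J u s = trans (X-coefficient (withZero (false ∷ J)) (u , s)) (cong ind (begin
  D ⊆ᵇ withZero (false ∷ J)
    ≡⟨ ⊆ᵇ-allBelow D (withZero (false ∷ J)) ⟩
  (not (at D 0) ∨ true) ∧ allBelow m (λ k → not (at D (suc k)) ∨ at (withZero (false ∷ J)) (suc k))
    ≡⟨ cong₂ _∧_ (∨-zeroʳ (not (at D 0))) (allBelow-cong m λ {k} k<m →
         cong₂ (λ d b → not d ∨ b) (at-Des u s k<m) (at-withZero false J k)) ⟩
  Chain.admissible cX (entries u) (at J) m (at s) ∎))
  where D = Des (u , s)

Y⁰-coefficient : ∀ {m} (J : Subset m) (u : Perm (suc m)) (s : Signs (suc m)) →
                 Y⁰ (false ∷ J) (u , s) ≡ ind (Chain.admissible cY (entries u) (at J) m (at s))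
Y⁰-coefficient {m} J u s = begin
  ind (D ==ˢ withZero (false ∷ J)) + ind (D ==ˢ (false ∷ J))
    ≡⟨ cong₂ (λ a b → ind a + ind b)
             (trans (==ˢ-allBelow D (withZero (false ∷ J))) (cong (not (at D 0 xor true) ∧_) links-withZero))
             (trans (==ˢ-allBelow D (false ∷ J)) (cong (not (at D 0 xor false) ∧_) links)) ⟩
  ind (not (at D 0 xor true) ∧ admissible) + ind (not (at D 0 xor false) ∧ admissible)
    ≡⟨ either-sign (at D 0) admissible ⟩
  ind admissible ∎
  where
  D = Des (u , s)
  admissible = Chain.admissible cY (entries u) (at J) m (at s)
  links-withZero : allBelow m (λ k → not (at D (suc k) xor at (withZero (false ∷ J)) (suc k))) ≡ admissible
  links-withZero = allBelow-cong m λ {k} k<m →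
    cong₂ (λ d b → not (d xor b)) (at-Des u s k<m) (at-withZero false J k)
  links : allBelow m (λ k → not (at D (suc k) xor at J k)) ≡ admissible
  links = allBelow-cong m λ {k} k<m → cong (λ d → not (d xor at J k)) (at-Des u s k<m)
  -- Y⁰_J = Y_{0∪J} + Y_J leaves the descent bit at position 0 free.
  either-sign : ∀ d a → ind (not (d xor true) ∧ a) + ind (not (d xor false) ∧ a) ≡ ind a
  either-sign true  a = +-identityʳ (ind a)
  either-sign false a = refl

Peak-⊆ᵇ : ∀ {m} (u : Perm (suc m)) (K : Subset (suc m)) →
          (Peak u ⊆ᵇ K) ≡ allBelow (pred m) (λ r → not (peakᵇ (entries u) r) ∨ at K (2 + r))
Peak-⊆ᵇ {zero}  u K = refl
Peak-⊆ᵇ {suc m} u K = trans (⊆ᵇ-allBelow (Peak u) K)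
  (allBelow-cong m λ {r} r<m → cong (λ b → not b ∨ at K (2 + r)) (at-tabulate (peakᵇ (entries u)) r<m))

∣Peak∣ : ∀ {m} (u : Perm (suc m)) → ∣ Peak u ∣ ≡ peakCount (entries u) m
∣Peak∣ {zero}  u = refl
∣Peak∣ {suc m} u = trans (∣∣-countBelow (tabulate {n = m} (peakᵇ (entries u) ∘ toℕ)))
  (countBelow-cong m λ r<m → at-tabulate {m} (peakᵇ (entries u)) r<m)

isF-Peak : ∀ {n} (u : Perm n) → isF (Peak u) ≡ true
isF-Peak {zero}        u = refl
isF-Peak {suc zero}    u = refl
isF-Peak {suc (suc m)} u = and-tabulate-true _ no-consecutive
  where
  e = entries u
  interior = tabulate {n = m} (peakᵇ e ∘ toℕ)
  isolated : ∀ r → not (peakᵇ e r) ∨ not (at interior (suc r)) ≡ true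
  isolated r with peakᵇ e r in peak
  ... | false = refl
  ... | true  = cong not (at-tabulate-false {m} (peakᵇ e) (peakᵇ-isolated e r peak))
  no-consecutive : ∀ i →
    not (lookup (Peak u) i) ∨ ((2 ≤ᵇ toℕ i) ∧ not (memℕ (Peak u) (suc (toℕ i)))) ≡ true
  no-consecutive fzero          = refl
  no-consecutive (fsuc fzero)    = refl
  no-consecutive (fsuc (fsuc i)) = trans
    (cong₂ (λ a b → not a ∨ not b) (lookup∘tabulate (peakᵇ e ∘ toℕ) i) (memℕ-at (Peak u) (3 + toℕ i)))
    (isolated (toℕ i))

at-shift-∷ : ∀ {m} (J : Subset m) {r} → r < pred m → at (shift (false ∷ J)) (2 + r) ≡ at J r
at-shift-∷ {suc m} J r<m = at-shift (false ∷ J) (s<s (s<s r<m))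

Peak-⊆ᵇ-∪ : ∀ {m} (J : Subset m) (u : Perm (suc m)) →
            (Peak u ⊆ᵇ ((false ∷ J) ∪ shift (false ∷ J))) ≡ peaksSatisfy _∨_ (entries u) (at J) m
Peak-⊆ᵇ-∪ {m} J u = trans (Peak-⊆ᵇ u ((false ∷ J) ∪ shift (false ∷ J))) (allBelow-cong (pred m) λ {r} r<m →
  cong (not (peakᵇ (entries u) r) ∨_)
       (trans (at-∪ (false ∷ J) (shift (false ∷ J)) (2 + r)) (cong (at J (suc r) ∨_) (at-shift-∷ J r<m))))

Peak-⊆ᵇ-△ : ∀ {m} (J : Subset m) (u : Perm (suc m)) →
            (Peak u ⊆ᵇ ((false ∷ J) △ shift (false ∷ J))) ≡ peaksSatisfy _xor_ (entries u) (at J) m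
Peak-⊆ᵇ-△ {m} J u = trans (Peak-⊆ᵇ u ((false ∷ J) △ shift (false ∷ J))) (allBelow-cong (pred m) λ {r} r<m →
  cong (not (peakᵇ (entries u) r) ∨_)
       (trans (at-△ (false ∷ J) (shift (false ∷ J)) (2 + r)) (cong (at J (suc r) xor_) (at-shift-∷ J r<m))))

rhsX≡τX : ∀ {m} (J : Subset m) (u : Perm (suc m)) → rhsX (false ∷ J) u ≡ τX (entries u) (at J) m
rhsX≡τX {m} J u = begin
  2 ^ (1 + ∣ J ∣) * sumAll (suc m) (λ F → g F (Peak u ==ˢ F))
    ≡⟨ cong (2 ^ (1 + ∣ J ∣) *_) (sumAll-==ˢ (Peak u) g (λ F → if-eta (isF F ∧ (F ⊆ᵇ K)))) ⟩
  2 ^ (1 + ∣ J ∣) * ind (isF (Peak u) ∧ (Peak u ⊆ᵇ K))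
    ≡⟨ cong₂ (λ k b → 2 ^ (1 + k) * ind b) (∣∣-countBelow J) (cong₂ _∧_ (isF-Peak u) (Peak-⊆ᵇ-∪ J u)) ⟩
  τX (entries u) (at J) m ∎
  where
  K = (false ∷ J) ∪ shift (false ∷ J)
  g : Subset (suc m) → Bool → ℕ
  g F b = if isF F ∧ (F ⊆ᵇ K) then ind b else 0

rhsY≡τY : ∀ {m} (J : Subset m) (u : Perm (suc m)) → rhsY (false ∷ J) u ≡ τY (entries u) (at J) m
rhsY≡τY {m} J u = begin
  sumAll (suc m) (λ F → g F (Peak u ==ˢ F))
    ≡⟨ sumAll-==ˢ (Peak u) g (λ F → weight-0 (isF F ∧ (F ⊆ᵇ K)) (2 ^ (1 + ∣ F ∣))) ⟩
  (if isF (Peak u) ∧ (Peak u ⊆ᵇ K) then 2 ^ (1 + ∣ Peak u ∣) * 1 else 0)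
    ≡⟨ weight-1 (isF (Peak u) ∧ (Peak u ⊆ᵇ K)) (2 ^ (1 + ∣ Peak u ∣)) ⟩
  2 ^ (1 + ∣ Peak u ∣) * ind (isF (Peak u) ∧ (Peak u ⊆ᵇ K))
    ≡⟨ cong₂ (λ k b → 2 ^ (1 + k) * ind b) (∣Peak∣ u) (cong₂ _∧_ (isF-Peak u) (Peak-⊆ᵇ-△ J u)) ⟩
  τY (entries u) (at J) m ∎
  where
  K = (false ∷ J) △ shift (false ∷ J)
  g : Subset (suc m) → Bool → ℕ
  g F b = if isF F ∧ (F ⊆ᵇ K) then 2 ^ (1 + ∣ F ∣) * ind b else 0
  weight-0 : ∀ b x → (if b then x * 0 else 0) ≡ 0
  weight-0 true  x = *-zeroʳ x
  weight-0 false x = refl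
  weight-1 : ∀ b x → (if b then x * 1 else 0) ≡ x * ind b
  weight-1 true  x = refl
  weight-1 false x = sym (*-zeroʳ x)

proposition5p8 : (n : ℕ) → 1 ≤ n → (J : Subset n) → (∀ (i : Fin n) → toℕ i ≡ 0 → i ∉ J) →
    ((u : Perm n) → φ (X⁰ J) u ≡ rhsX J u) × ((u : Perm n) → φ (Y⁰ J) u ≡ rhsY J u)
proposition5p8 (suc m) _ (true  ∷ J) 0∉J = ⊥-elim (0∉J fzero refl here)
proposition5p8 (suc m) _ (false ∷ J) _   = φX⁰≡rhsX , φY⁰≡rhsY
  where
  φX⁰≡rhsX : ∀ u → φ (X⁰ (false ∷ J)) u ≡ rhsX (false ∷ J) u
  φX⁰≡rhsX u = begin
    φ (X⁰ (false ∷ J)) u                ≡⟨ Chain.φ≡total cX (X⁰ (false ∷ J)) u (X⁰-coefficient J u) ⟩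
    Chain.total cX (entries u) (at J) m ≡⟨ Chain.total≡τ cX X-recurrence m _ _ (entries-distinct u) ⟩
    τX (entries u) (at J) m             ≡⟨ rhsX≡τX J u ⟨
    rhsX (false ∷ J) u                  ∎

  φY⁰≡rhsY : ∀ u → φ (Y⁰ (false ∷ J)) u ≡ rhsY (false ∷ J) u
  φY⁰≡rhsY u = begin
    φ (Y⁰ (false ∷ J)) u                ≡⟨ Chain.φ≡total cY (Y⁰ (false ∷ J)) u (Y⁰-coefficient J u) ⟩
    Chain.total cY (entries u) (at J) m ≡⟨ Chain.total≡τ cY Y-recurrence m _ _ (entries-distinct u) ⟩
    τY (entries u) (at J) m             ≡⟨ rhsY≡τY J u ⟨
    rhsY (false ∷ J) u                  ∎
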